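{- Let $n$ be a prime, let $a,b\in\mathbb{Z}_n$ be nonzero, and let $v,w\in\{1,\ldots,n-1\}$ be coprime integers with $va=wb$ in $\mathbb{Z}_n$. Let $t,s$ be integers with $t\ge 2v$ and $s\ge 2w$, and put $z=a/w=b/v\in\mathbb{Z}_n$. Then there exist $c\in\mathbb{Z}_n$ and an integer $u\ge 2vw$ such that $c+AP(z,u)\subseteq AP(a,t)+AP(b,s)$.
   Context: $\mathbb{Z}_n=\mathbb{Z}/n\mathbb{Z}$ (a field since $n$ is prime). For $a\in\mathbb{Z}_n$ and a nonnegative integer $k$, $AP(a,k)=\{0,a,2a,\ldots,ka\}$. For sets $X,Y$, $X+Y=\{x+y:x\in X,y\in Y\}$ and $c+X=\{c+x:x\in X\}$. -}

module Defs where

open import Data.Nat using (ℕ; _+_; _*_; _≤_; NonZero)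
open import Data.Nat.DivMod using (_%_)
open import Data.Product using (∃-syntax; _×_)
open import Relation.Binary.PropositionalEquality using (_≡_)

-- Elements of ℤ_n are represented by natural numbers; two naturals denote
-- the same element of ℤ_n iff they agree modulo n.
_≡[mod_]_ : ℕ → (n : ℕ) → .{{NonZero n}} → ℕ → Set
x ≡[mod n ] y = x % n ≡ y % n

_∈AP[_,_]mod_ : ℕ → ℕ → ℕ → (n : ℕ) → .{{NonZero n}} → Set
x ∈AP[ a , k ]mod n = ∃[ i ] (i ≤ k × x ≡[mod n ] (i * a))

_∈AP[_,_]+AP[_,_]mod_ : ℕ → ℕ → ℕ → ℕ → ℕ → (n : ℕ) → .{{NonZero n}} → Set
x ∈AP[ a , t ]+AP[ b , s ]mod n =
  ∃[ i ] ∃[ j ] (i ≤ t × j ≤ s × x ≡[mod n ] (i * a + j * b))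

TranslateAPSubset : (n c z u a t b s : ℕ) → .{{NonZero n}} → Set
TranslateAPSubset n c z u a t b s =
  ∀ k → k ≤ u → (c + k * z) ∈AP[ a , t ]+AP[ b , s ]mod n

-- Put c = vwz. Since wz = a and vz = b in ℤ_n, a point c + kz = (vw + k)z of
-- c + AP(z, 2vw) equals ia + jb as soon as vw + k = iw + jv over ℕ. For coprime
-- v and w, every integer m in [vw, 3vw] has such a representation with i ≤ 2v
-- and j ≤ 2w: choose i < v with iw ≡ m (mod v), so that m = iw + jv with j ≥ 0,
-- and if j > 2w trade (i, j) for (i + v, j − w).
module Submission where

open import Defs
open import Data.Nat using (ℕ; suc; _+_; _*_; _∸_; _≤_; _<_; NonZero; >-nonZero; _≤?_)
open import Data.Nat.Properties
open import Data.Nat.DivMod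
open import Data.Nat.GCD using (module Bézout)
open import Data.Nat.Primality using (Prime)
open import Data.Nat.Coprimality using (Coprime; coprime-Bézout)
open import Data.Nat.Solver using (module +-*-Solver)
open import Data.Product using (∃-syntax; _×_; _,_)
open import Relation.Nullary using (¬_; yes; no)
open import Relation.Binary.PropositionalEquality
open ≡-Reasoning
open +-*-Solver

module _ {n : ℕ} .{{_ : NonZero n}} where

  +-cong-mod : ∀ {x x′ y y′} → x ≡[mod n ] x′ → y ≡[mod n ] y′ → (x + y) ≡[mod n ] (x′ + y′)
  +-cong-mod {x} {x′} {y} {y′} x≡x′ y≡y′ = begin
    (x + y) % n               ≡⟨ %-distribˡ-+ x y n ⟩
    (x % n + y % n) % n       ≡⟨ cong₂ (λ p q → (p + q) % n) x≡x′ y≡y′ ⟩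
    (x′ % n + y′ % n) % n     ≡⟨ %-distribˡ-+ x′ y′ n ⟨
    (x′ + y′) % n             ∎

  *-cong-mod : ∀ {x x′ y y′} → x ≡[mod n ] x′ → y ≡[mod n ] y′ → (x * y) ≡[mod n ] (x′ * y′)
  *-cong-mod {x} {x′} {y} {y′} x≡x′ y≡y′ = begin
    (x * y) % n               ≡⟨ %-distribˡ-* x y n ⟩
    (x % n * (y % n)) % n     ≡⟨ cong₂ (λ p q → (p * q) % n) x≡x′ y≡y′ ⟩
    (x′ % n * (y′ % n)) % n   ≡⟨ %-distribˡ-* x′ y′ n ⟨
    (x′ * y′) % n             ∎

  [iw+jv]*z≡ia+jb : ∀ {a b v w z} i j → (w * z) ≡[mod n ] a → (v * z) ≡[mod n ] b →
                    ((i * w + j * v) * z) ≡[mod n ] (i * a + j * b)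
  [iw+jv]*z≡ia+jb {a} {b} {v} {w} {z} i j wz≡a vz≡b = begin
    ((i * w + j * v) * z) % n     ≡⟨ cong (_% n) (solve 5 (λ i j v w z → (i :* w :+ j :* v) :* z := i :* (w :* z) :+ j :* (v :* z)) refl i j v w z) ⟩
    (i * (w * z) + j * (v * z)) % n ≡⟨ +-cong-mod (*-cong-mod {x = i} refl wz≡a) (*-cong-mod {x = j} refl vz≡b) ⟩
    (i * a + j * b) % n           ∎

  ≡-mod⇒+-multiple : ∀ {x y} → x ≤ y → y ≡[mod n ] x → ∃[ j ] (x + j * n ≡ y)
  ≡-mod⇒+-multiple {x} {y} x≤y y≡x = y / n ∸ x / n , (begin
    x + (y / n ∸ x / n) * n                   ≡⟨ cong (_+ (y / n ∸ x / n) * n) (m≡m%n+[m/n]*n x n) ⟩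
    x % n + x / n * n + (y / n ∸ x / n) * n   ≡⟨ +-assoc (x % n) _ _ ⟩
    x % n + (x / n * n + (y / n ∸ x / n) * n) ≡⟨ cong (x % n +_) (*-distribʳ-+ n (x / n) _) ⟨
    x % n + (x / n + (y / n ∸ x / n)) * n     ≡⟨ cong (λ q → x % n + q * n) (m+[n∸m]≡n (/-monoˡ-≤ n x≤y)) ⟩
    x % n + y / n * n                         ≡⟨ cong (_+ y / n * n) y≡x ⟨
    y % n + y / n * n                         ≡⟨ m≡m%n+[m/n]*n y n ⟨
    y                                         ∎)

coprime⇒invertible-mod : ∀ {v w} .{{_ : NonZero v}} → Coprime v w → ∃[ x ] ((x * w) ≡[mod v ] 1)
coprime⇒invertible-mod {v@(suc v′)} {w} v⊥w with coprime-Bézout v⊥w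
... | Bézout.-+ x y 1+xv≡yw = y , (begin
  (y * w) % v         ≡⟨ cong (_% v) 1+xv≡yw ⟨
  (1 + x * v) % v     ≡⟨ [m+kn]%n≡m%n 1 x v ⟩
  1 % v               ∎)
... | Bézout.+- x y 1+yw≡xv = v′ * y , (begin
  (v′ * y * w) % v              ≡⟨ [m+n]%n≡m%n (v′ * y * w) v ⟨
  (v′ * y * w + v) % v          ≡⟨ cong (_% v) shift ⟩
  (1 + v′ * x * v) % v          ≡⟨ [m+kn]%n≡m%n 1 (v′ * x) v ⟩
  1 % v                         ∎)
  where
  shift : v′ * y * w + suc v′ ≡ 1 + v′ * x * suc v′
  shift = begin
    v′ * y * w + suc v′   ≡⟨ solve 3 (λ p q r → p :* q :* r :+ (con 1 :+ p) := con 1 :+ p :* (con 1 :+ q :* r)) refl v′ y w ⟩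
    1 + v′ * (1 + y * w)  ≡⟨ cong (λ q → 1 + v′ * q) 1+yw≡xv ⟩
    1 + v′ * (x * suc v′) ≡⟨ cong (1 +_) (*-assoc v′ x (suc v′)) ⟨
    1 + v′ * x * suc v′   ∎

coprime⇒∃-residue : ∀ {v w} .{{_ : NonZero v}} → Coprime v w →
                     ∀ m → ∃[ i ] (i < v × (i * w) ≡[mod v ] m)
coprime⇒∃-residue {v} {w} v⊥w m with coprime⇒invertible-mod v⊥w
... | x , xw≡1 = (m * x) % v , m%n<n (m * x) v , (begin
  ((m * x) % v * w) % v   ≡⟨ *-cong-mod (m%n%n≡m%n (m * x) v) refl ⟩
  (m * x * w) % v         ≡⟨ cong (_% v) (*-assoc m x w) ⟩
  (m * (x * w)) % v       ≡⟨ *-cong-mod {x = m} refl xw≡1 ⟩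
  (m * 1) % v             ≡⟨ cong (_% v) (*-identityʳ m) ⟩
  m % v                   ∎)

coprime⇒bounded-representation :
  ∀ {v w} .{{_ : NonZero v}} → Coprime v w → ∀ k → k ≤ 2 * v * w →
  ∃[ i ] ∃[ j ] (i ≤ 2 * v × j ≤ 2 * w × i * w + j * v ≡ v * w + k)
coprime⇒bounded-representation {v} {w} v⊥w k k≤2vw
  with coprime⇒∃-residue v⊥w (v * w + k)
... | i , i<v , iw≡m
  with ≡-mod⇒+-multiple (≤-trans (*-monoˡ-≤ w (<⇒≤ i<v)) (m≤m+n (v * w) k)) (sym iw≡m)
... | j , iw+jv≡m
  with j ≤? 2 * w
... | yes j≤2w = i , j , ≤-trans (<⇒≤ i<v) (m≤m+n v _) , j≤2w , iw+jv≡m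
... | no j≰2w = i + v , j ∸ w , i+v≤2v , j∸w≤2w , (begin
  (i + v) * w + (j ∸ w) * v   ≡⟨ solve 4 (λ i v w d → (i :+ v) :* w :+ d :* v := i :* w :+ (w :+ d) :* v) refl i v w (j ∸ w) ⟩
  i * w + (w + (j ∸ w)) * v   ≡⟨ cong (λ q → i * w + q * v) (m+[n∸m]≡n w≤j) ⟩
  i * w + j * v               ≡⟨ iw+jv≡m ⟩
  v * w + k                   ∎)
  where
  w≤j : w ≤ j
  w≤j = ≤-trans (m≤m+n w _) (<⇒≤ (≰⇒> j≰2w))

  i+v≤2v : i + v ≤ 2 * v
  i+v≤2v = ≤-trans (+-monoˡ-≤ v (<⇒≤ i<v)) (≤-reflexive (cong (v +_) (sym (+-identityʳ v))))

  jv≤3wv : j * v ≤ 3 * w * v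
  jv≤3wv = ≤-trans (m≤n+m (j * v) (i * w)) (≤-trans (≤-reflexive iw+jv≡m)
    (≤-trans (+-monoʳ-≤ (v * w) k≤2vw)
      (≤-reflexive (solve 2 (λ v w → v :* w :+ con 2 :* v :* w := con 3 :* w :* v) refl v w))))

  -- 3 * w and w + 2 * w are the same term, so j ≤ 3w is already j ≤ w + 2w.
  j∸w≤2w : j ∸ w ≤ 2 * w
  j∸w≤2w = m≤n+o⇒m∸n≤o j w (*-cancelʳ-≤ j (3 * w) v jv≤3wv)

proposition11 : (n : ℕ) → .{{_ : NonZero n}} → Prime n →
    (a b : ℕ) → ¬ (a ≡[mod n ] 0) → ¬ (b ≡[mod n ] 0) →
    (v w : ℕ) → 1 ≤ v → v < n → 1 ≤ w → w < n → Coprime v w →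
    (v * a) ≡[mod n ] (w * b) →
    (t s : ℕ) → 2 * v ≤ t → 2 * w ≤ s →
    (z : ℕ) → (w * z) ≡[mod n ] a → (v * z) ≡[mod n ] b →
    ∃[ c ] ∃[ u ] (2 * v * w ≤ u × TranslateAPSubset n c z u a t b s)
proposition11 n _ a b _ _ v w 1≤v _ _ _ v⊥w _ t s 2v≤t 2w≤s z wz≡a vz≡b =
  v * w * z , 2 * v * w , ≤-refl , c+kz∈sumset
  where
  instance
    v≢0 : NonZero v
    v≢0 = >-nonZero 1≤v

  c+kz∈sumset : TranslateAPSubset n (v * w * z) z (2 * v * w) a t b s
  c+kz∈sumset k k≤2vw with coprime⇒bounded-representation v⊥w k k≤2vw
  ... | i , j , i≤2v , j≤2w , iw+jv≡vw+k =
    i , j , ≤-trans i≤2v 2v≤t , ≤-trans j≤2w 2w≤s , (begin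
      (v * w * z + k * z) % n     ≡⟨ cong (_% n) (*-distribʳ-+ z (v * w) k) ⟨
      ((v * w + k) * z) % n       ≡⟨ cong (λ m → (m * z) % n) iw+jv≡vw+k ⟨
      ((i * w + j * v) * z) % n   ≡⟨ [iw+jv]*z≡ia+jb i j wz≡a vz≡b ⟩
      (i * a + j * b) % n         ∎)
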